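{- For every integer $k\ge 2$ we have $m(k,4;2^{2k-3})=\frac{4^k-1}{3}$.
   Context: A linear $[n,k]_q$-code is a $k$-dimensional subspace of $\mathbb{F}_q^n$. The support of $c\in\mathbb{F}_q^n$ is $\operatorname{supp}(c)=\{i: c_i\neq 0\}$. A non-zero codeword $c$ of a linear code $C$ is minimal if no non-zero codeword $u\in C$ has $\operatorname{supp}(u)\subsetneq\operatorname{supp}(c)$; $C$ is a minimal code if all its non-zero codewords are minimal. A linear code is $\Delta$-divisible if the Hamming weights of all its codewords are divisible by $\Delta$. For positive integers $k,\Delta$, $m(k,q;\Delta)$ denotes the minimum length $n$ of a $\Delta$-divisible minimal $[n,k]_q$-code. -}

module Defs where

open import Data.Nat using (ℕ; zero; suc; _≤_; _∸_; _^_) renaming (_+_ to _+ℕ_; _*_ to _*ℕ_)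
open import Data.Nat.DivMod using (_/_)
open import Data.Nat.Divisibility using (_∣_)
open import Data.Fin using (Fin; zero; suc)
open import Data.Bool using (Bool; true; false; if_then_else_)
open import Data.Product using (Σ; ∃; _×_)
open import Relation.Binary.PropositionalEquality using (_≡_; _≢_)
open import Relation.Nullary using (¬_)

data F4 : Set where
  𝟎 𝟏 ω ω² : F4

infixl 6 _⊕_
infixl 7 _⊗_

_⊕_ : F4 → F4 → F4
𝟎  ⊕ y  = y
x  ⊕ 𝟎  = x
𝟏  ⊕ 𝟏  = 𝟎
𝟏  ⊕ ω  = ω²
𝟏  ⊕ ω² = ω
ω  ⊕ 𝟏  = ω²
ω  ⊕ ω  = 𝟎
ω  ⊕ ω² = 𝟏
ω² ⊕ 𝟏  = ω
ω² ⊕ ω  = 𝟏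
ω² ⊕ ω² = 𝟎

_⊗_ : F4 → F4 → F4
𝟎  ⊗ y  = 𝟎
𝟏  ⊗ y  = y
ω  ⊗ 𝟎  = 𝟎
ω  ⊗ 𝟏  = ω
ω  ⊗ ω  = ω²
ω  ⊗ ω² = 𝟏
ω² ⊗ 𝟎  = 𝟎
ω² ⊗ 𝟏  = ω²
ω² ⊗ ω  = 𝟏
ω² ⊗ ω² = ω

Word : ℕ → Set
Word n = Fin n → F4

sumF4 : ∀ {k} → (Fin k → F4) → F4
sumF4 {zero}  f = 𝟎
sumF4 {suc k} f = f zero ⊕ sumF4 (λ i → f (suc i))

GenMatrix : ℕ → ℕ → Set
GenMatrix k n = Fin k → Word n

encode : ∀ {k n} → GenMatrix k n → (Fin k → F4) → Word n
encode G m j = sumF4 (λ i → m i ⊗ G i j)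

LinIndep : ∀ {k n} → GenMatrix k n → Set
LinIndep {k} {n} G = ∀ (m : Fin k → F4) → (∀ j → encode G m j ≡ 𝟎) → ∀ i → m i ≡ 𝟎

_∈C_ : ∀ {k n} → Word n → GenMatrix k n → Set
_∈C_ {k} {n} c G = Σ (Fin k → F4) (λ m → ∀ j → c j ≡ encode G m j)

NonZeroWord : ∀ {n} → Word n → Set
NonZeroWord {n} c = Σ (Fin n) (λ j → c j ≢ 𝟎)

StrictSuppSub : ∀ {n} → Word n → Word n → Set
StrictSuppSub {n} u c = (∀ j → u j ≢ 𝟎 → c j ≢ 𝟎) × Σ (Fin n) (λ j → c j ≢ 𝟎 × u j ≡ 𝟎)

IsMinimalCode : ∀ {k n} → GenMatrix k n → Set
IsMinimalCode {k} {n} G = ∀ (c u : Word n) → c ∈C G → NonZeroWord c →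
  u ∈C G → NonZeroWord u → ¬ StrictSuppSub u c

isZero : F4 → Bool
isZero 𝟎 = true
isZero _ = false

weight : ∀ {n} → Word n → ℕ
weight {zero}  c = 0
weight {suc n} c = (if isZero (c zero) then 0 else 1) +ℕ weight (λ j → c (suc j))

IsDivisible : ∀ {k n} → ℕ → GenMatrix k n → Set
IsDivisible {k} {n} Δ G = ∀ (c : Word n) → c ∈C G → Δ ∣ weight c

IsDivMinCode : (Δ k n : ℕ) → GenMatrix k n → Set
IsDivMinCode Δ k n G = LinIndep G × IsMinimalCode G × IsDivisible Δ G

-- "m(k,4;Δ) = N": N is the minimum length of a Δ-divisible minimal [n,k]_4 code
MinLengthIs : (k Δ N : ℕ) → Set
MinLengthIs k Δ N =
  Σ (GenMatrix k N) (IsDivMinCode Δ k N) ×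
  (∀ (n : ℕ) (G : GenMatrix k n) → IsDivMinCode Δ k n G → N ≤ n)

{-# OPTIONS --safe #-}
-- The simplex code, whose (4ᵏ − 1)/3 columns represent the points of PG(k − 1, 4), has every
-- nonzero weight equal to 4ᵏ⁻¹ = 2Δ for Δ = 2^(2k − 3); a constant-weight code is minimal.
--
-- Conversely, let C be a Δ-divisible minimal [n, k]₄ code. If a codeword c had weight Δ, then for
-- every codeword w ∉ ⟨c⟩ the counts N_a = #{j ∈ supp c : w_j = a c_j} (a ∈ F₄) satisfy
-- wt(w + a c) + N_a = const, so they agree modulo Δ; minimality forces N_a < Δ, so all four equal
-- Δ/4. Applying this to the codewords spanned by a complement of ⟨c⟩, and restricting to the
-- kernel of one form at a time, yields 4ᵏ⁻¹ ∣ Δ, which is false. Hence every nonzero weight is at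
-- least 2Δ = 4ᵏ⁻¹, and as each nonzero coordinate is nonzero on exactly 3/4 of C, averaging the
-- weight over C gives (4ᵏ − 1) 4ᵏ⁻¹ ≤ 3 n 4ᵏ⁻¹.
module Submission where

open import Defs
open import Data.Nat using (ℕ; zero; suc; _+_; _*_; _∸_; _^_; _≤_; _<_; z≤n; s≤s)
open import Data.Nat.Properties hiding (_≟_)
import Data.Nat.Properties as ℕₚ
open import Data.Nat.DivMod using (_/_; _%_; m*n/n≡m; /-monoˡ-≤; m<n⇒m%n≡m; [m+kn]%n≡m%n)
open import Data.Nat.Divisibility using (_∣_; divides; ∣⇒≤; 1∣_; *-monoʳ-∣)
open import Data.Nat.Tactic.RingSolver using (solve-∀)
open import Algebra.Properties.Semiring.Sum +-*-semiring
  using (sum; sum-cong-≗; ∑-distrib-+; ∑-comm; *-distribˡ-sum)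
open import Data.Fin using (Fin; zero; suc; punchIn; splitAt)
open import Data.Fin.Properties using (¬∀⟶∃¬)
open import Data.Vec.Functional using (Vector; []; _∷_; _++_; map; tail; insertAt)
open import Data.Vec.Functional.Properties using (insertAt-lookup; insertAt-punchIn)
open import Data.Bool using (if_then_else_)
open import Data.Product using (Σ; _,_; proj₁; proj₂)
open import Data.Sum using (_⊎_; inj₁; inj₂)
open import Data.Sum.Properties using ([,]-∘; [,]-map)
open import Data.Empty using (⊥-elim)
open import Function using (_∘_)
open import Relation.Binary.Definitions using (DecidableEquality)
open import Relation.Binary.PropositionalEquality
open import Relation.Nullary using (Dec; yes; no; ¬_)
open import Relation.Nullary.Decidable using (map′; from-yes; _×-dec_; _→-dec_; ¬?)

-- The field F₄

infix 4 _≟_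

_≟_ : DecidableEquality F4
𝟎  ≟ 𝟎  = yes refl
𝟎  ≟ 𝟏  = no λ ()
𝟎  ≟ ω  = no λ ()
𝟎  ≟ ω² = no λ ()
𝟏  ≟ 𝟎  = no λ ()
𝟏  ≟ 𝟏  = yes refl
𝟏  ≟ ω  = no λ ()
𝟏  ≟ ω² = no λ ()
ω  ≟ 𝟎  = no λ ()
ω  ≟ 𝟏  = no λ ()
ω  ≟ ω  = yes refl
ω  ≟ ω² = no λ ()
ω² ≟ 𝟎  = no λ ()
ω² ≟ 𝟏  = no λ ()
ω² ≟ ω  = no λ ()
ω² ≟ ω² = yes refl

all? : {P : F4 → Set} → (∀ x → Dec (P x)) → Dec (∀ x → P x)
all? P? = map′ (λ (p₀ , p₁ , p₂ , p₃) → λ { 𝟎 → p₀ ; 𝟏 → p₁ ; ω → p₂ ; ω² → p₃ })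
               (λ p → p 𝟎 , p 𝟏 , p ω , p ω²)
               (P? 𝟎 ×-dec P? 𝟏 ×-dec P? ω ×-dec P? ω²)

⊕-identityʳ : ∀ x → x ⊕ 𝟎 ≡ x
⊕-identityʳ = from-yes (all? λ x → x ⊕ 𝟎 ≟ x)

⊕-assoc : ∀ x y z → (x ⊕ y) ⊕ z ≡ x ⊕ (y ⊕ z)
⊕-assoc = from-yes (all? λ x → all? λ y → all? λ z → (x ⊕ y) ⊕ z ≟ x ⊕ (y ⊕ z))

⊕-interchange : ∀ x y z w → (x ⊕ y) ⊕ (z ⊕ w) ≡ (x ⊕ z) ⊕ (y ⊕ w)
⊕-interchange = from-yes (all? λ x → all? λ y → all? λ z → all? λ w →
  (x ⊕ y) ⊕ (z ⊕ w) ≟ (x ⊕ z) ⊕ (y ⊕ w))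

⊕-left-comm : ∀ x y z → x ⊕ (y ⊕ z) ≡ y ⊕ (x ⊕ z)
⊕-left-comm = from-yes (all? λ x → all? λ y → all? λ z → x ⊕ (y ⊕ z) ≟ y ⊕ (x ⊕ z))

⊕-self : ∀ x → x ⊕ x ≡ 𝟎
⊕-self = from-yes (all? λ x → x ⊕ x ≟ 𝟎)

x⊕y≡𝟎⇒x≡y : ∀ x y → x ⊕ y ≡ 𝟎 → x ≡ y
x⊕y≡𝟎⇒x≡y = from-yes (all? λ x → all? λ y → (x ⊕ y ≟ 𝟎) →-dec (x ≟ y))

⊗-identityʳ : ∀ x → x ⊗ 𝟏 ≡ x
⊗-identityʳ = from-yes (all? λ x → x ⊗ 𝟏 ≟ x)

⊗-zeroʳ : ∀ x → x ⊗ 𝟎 ≡ 𝟎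
⊗-zeroʳ = from-yes (all? λ x → x ⊗ 𝟎 ≟ 𝟎)

⊗-comm : ∀ x y → x ⊗ y ≡ y ⊗ x
⊗-comm = from-yes (all? λ x → all? λ y → x ⊗ y ≟ y ⊗ x)

⊗-assoc : ∀ x y z → (x ⊗ y) ⊗ z ≡ x ⊗ (y ⊗ z)
⊗-assoc = from-yes (all? λ x → all? λ y → all? λ z → (x ⊗ y) ⊗ z ≟ x ⊗ (y ⊗ z))

⊗-distribˡ-⊕ : ∀ x y z → x ⊗ (y ⊕ z) ≡ x ⊗ y ⊕ x ⊗ z
⊗-distribˡ-⊕ = from-yes (all? λ x → all? λ y → all? λ z → x ⊗ (y ⊕ z) ≟ x ⊗ y ⊕ x ⊗ z)

⊗-distribʳ-⊕ : ∀ x y z → (y ⊕ z) ⊗ x ≡ y ⊗ x ⊕ z ⊗ x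
⊗-distribʳ-⊕ = from-yes (all? λ x → all? λ y → all? λ z → (y ⊕ z) ⊗ x ≟ y ⊗ x ⊕ z ⊗ x)

x⊗y≡𝟎⇒x≡𝟎 : ∀ x y → y ≢ 𝟎 → x ⊗ y ≡ 𝟎 → x ≡ 𝟎
x⊗y≡𝟎⇒x≡𝟎 = from-yes (all? λ x → all? λ y → ¬? (y ≟ 𝟎) →-dec (x ⊗ y ≟ 𝟎) →-dec (x ≟ 𝟎))

weight₁ : F4 → ℕ
weight₁ x = if isZero x then 0 else 1

δ₀ : F4 → ℕ
δ₀ x = if isZero x then 1 else 0

elements : Vector F4 4
elements = 𝟎 ∷ 𝟏 ∷ ω ∷ ω² ∷ []

∑F4 : (F4 → ℕ) → ℕ
∑F4 f = sum (λ i → f (elements i))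

∑F4-cong : ∀ {f g : F4 → ℕ} → (∀ a → f a ≡ g a) → ∑F4 f ≡ ∑F4 g
∑F4-cong f≗g = sum-cong-≗ (λ i → f≗g (elements i))

∑F4-quarter : ∀ (f : F4 → ℕ) x → (∀ a → 4 * f a ≡ x) → ∑F4 f ≡ x
∑F4-quarter f x 4f≡x = *-cancelˡ-≡ (∑F4 f) x 4 (begin
  4 * ∑F4 f                 ≡⟨ *-distribˡ-sum 4 (λ i → f (elements i)) ⟩
  ∑F4 (λ a → 4 * f a)       ≡⟨ ∑F4-cong 4f≡x ⟩
  4 * x                     ∎)
  where open ≡-Reasoning

weight₁+δ₀≡1 : ∀ x → weight₁ x + δ₀ x ≡ 1
weight₁+δ₀≡1 = from-yes (all? λ x → weight₁ x + δ₀ x ℕₚ.≟ 1)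

x≢𝟎⇒weight₁≡1 : ∀ x → x ≢ 𝟎 → weight₁ x ≡ 1
x≢𝟎⇒weight₁≡1 = from-yes (all? λ x → ¬? (x ≟ 𝟎) →-dec (weight₁ x ℕₚ.≟ 1))

weight₁-mono : ∀ x y → (x ≢ 𝟎 → y ≢ 𝟎) → weight₁ x ≤ weight₁ y
weight₁-mono = from-yes (all? λ x → all? λ y → (¬? (x ≟ 𝟎) →-dec ¬? (y ≟ 𝟎)) →-dec (weight₁ x ℕₚ.≤? weight₁ y))

-- Exactly one a ∈ F₄ solves w = a c when c ≠ 0.
∑F4-multiple : ∀ w c → ∑F4 (λ a → weight₁ c * δ₀ (w ⊕ a ⊗ c)) ≡ weight₁ c
∑F4-multiple = from-yes (all? λ w → all? λ c → ∑F4 (λ a → weight₁ c * δ₀ (w ⊕ a ⊗ c)) ℕₚ.≟ weight₁ c)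

∑F4-solution : ∀ a s → a ≢ 𝟎 → ∑F4 (λ b → δ₀ (s ⊕ a ⊗ b)) ≡ 1
∑F4-solution = from-yes (all? λ a → all? λ s → ¬? (a ≟ 𝟎) →-dec (∑F4 (λ b → δ₀ (s ⊕ a ⊗ b)) ℕₚ.≟ 1))

weight₁*δ₀≤weight₁ : ∀ c v → weight₁ c * δ₀ v ≤ weight₁ c
weight₁*δ₀≤weight₁ = from-yes (all? λ c → all? λ v → weight₁ c * δ₀ v ℕₚ.≤? weight₁ c)

weight₁*δ₀≡weight₁ : ∀ c v → weight₁ c * δ₀ v ≡ weight₁ c → c ≢ 𝟎 → v ≡ 𝟎
weight₁*δ₀≡weight₁ = from-yes (all? λ c → all? λ v →
  (weight₁ c * δ₀ v ℕₚ.≟ weight₁ c) →-dec ¬? (c ≟ 𝟎) →-dec (v ≟ 𝟎))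

-- Off supp c the symbol w + a c is w; on supp c it is nonzero unless w = a c.
weight₁-shift : ∀ w c a →
  weight₁ (w ⊕ a ⊗ c) + weight₁ c * δ₀ (w ⊕ a ⊗ c) ≡ δ₀ c * weight₁ w + weight₁ c
weight₁-shift = from-yes (all? λ w → all? λ c → all? λ a →
  weight₁ (w ⊕ a ⊗ c) + weight₁ c * δ₀ (w ⊕ a ⊗ c) ℕₚ.≟ δ₀ c * weight₁ w + weight₁ c)

-- If u ≠ 0 exactly one a solves a u + x = t; if u = 0 all four a do, iff x = t.
δ₀-split : ∀ u x t → δ₀ u + ∑F4 (λ a → δ₀ ((a ⊗ u ⊕ x) ⊕ t)) ≡ 1 + 4 * (δ₀ u * δ₀ (x ⊕ t))
δ₀-split = from-yes (all? λ u → all? λ x → all? λ t →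
  δ₀ u + ∑F4 (λ a → δ₀ ((a ⊗ u ⊕ x) ⊕ t)) ℕₚ.≟ 1 + 4 * (δ₀ u * δ₀ (x ⊕ t)))

-- Sums and Hamming weights

sum-const : ∀ n x → sum {n} (λ _ → x) ≡ n * x
sum-const zero    x = refl
sum-const (suc n) x = cong (x +_) (sum-const n x)

sum-mono-≤ : ∀ {n} {f g : Vector ℕ n} → (∀ i → f i ≤ g i) → sum f ≤ sum g
sum-mono-≤ {zero}  f≤g = z≤n
sum-mono-≤ {suc n} f≤g = +-mono-≤ (f≤g zero) (sum-mono-≤ (f≤g ∘ suc))

sum-≤-≡⇒≗ : ∀ {n} {f g : Vector ℕ n} → (∀ i → f i ≤ g i) → sum f ≡ sum g → ∀ i → f i ≡ g i
sum-≤-≡⇒≗ {suc n} {f} {g} f≤g ∑f≡∑g = pointwise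
  where
  head≡ : f zero ≡ g zero
  head≡ = ≤-antisym (f≤g zero) (+-cancelʳ-≤ (sum (tail f)) (g zero) (f zero) (begin
    g zero + sum (tail f) ≤⟨ +-monoʳ-≤ (g zero) (sum-mono-≤ (f≤g ∘ suc)) ⟩
    g zero + sum (tail g) ≡⟨ sym ∑f≡∑g ⟩
    f zero + sum (tail f) ∎))
    where open ≤-Reasoning
  pointwise : ∀ i → f i ≡ g i
  pointwise zero    = head≡
  pointwise (suc i) = sum-≤-≡⇒≗ (f≤g ∘ suc)
    (+-cancelˡ-≡ (f zero) _ _ (trans ∑f≡∑g (cong (_+ sum (tail g)) (sym head≡)))) i

sum-bound : ∀ {n} K (f : Vector ℕ n) → (∀ i → 4 * f i ≤ K) → 4 * sum f ≤ n * K
sum-bound {n} K f 4f≤K = begin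
  4 * sum f               ≡⟨ *-distribˡ-sum 4 f ⟩
  sum (λ i → 4 * f i)     ≤⟨ sum-mono-≤ 4f≤K ⟩
  sum {n} (λ _ → K)       ≡⟨ sum-const n K ⟩
  n * K                   ∎
  where open ≤-Reasoning

sum-++ : ∀ {m n} (xs : Vector ℕ m) (ys : Vector ℕ n) → sum (xs ++ ys) ≡ sum xs + sum ys
sum-++ {zero}  xs ys = refl
sum-++ {suc m} xs ys = begin
  xs zero + sum (tail (xs ++ ys))  ≡⟨ cong (xs zero +_) (sum-cong-≗ (λ i → [,]-map (splitAt m i))) ⟩
  xs zero + sum (tail xs ++ ys)    ≡⟨ cong (xs zero +_) (sum-++ (tail xs) ys) ⟩
  xs zero + (sum (tail xs) + sum ys) ≡⟨ sym (+-assoc (xs zero) _ _) ⟩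
  sum xs + sum ys                  ∎
  where open ≡-Reasoning

sum-map-++ : ∀ {A : Set} {m n} (f : A → ℕ) (xs : Vector A m) (ys : Vector A n) →
  sum (map f (xs ++ ys)) ≡ sum (map f xs) + sum (map f ys)
sum-map-++ {m = m} f xs ys =
  trans (sum-cong-≗ (λ i → [,]-∘ f (splitAt m i))) (sum-++ (map f xs) (map f ys))

weight≡sum : ∀ {n} (c : Word n) → weight c ≡ sum (λ j → weight₁ (c j))
weight≡sum {zero}  c = refl
weight≡sum {suc n} c = cong (weight₁ (c zero) +_) (weight≡sum (tail c))

weight-cong : ∀ {n} {u v : Word n} → (∀ j → u j ≡ v j) → weight u ≡ weight v
weight-cong {u = u} {v} u≗v = begin
  weight u                    ≡⟨ weight≡sum u ⟩
  sum (λ j → weight₁ (u j))   ≡⟨ sum-cong-≗ (cong weight₁ ∘ u≗v) ⟩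
  sum (λ j → weight₁ (v j))   ≡⟨ sym (weight≡sum v) ⟩
  weight v                    ∎
  where open ≡-Reasoning

weight-𝟎 : ∀ {n} (c : Word n) → (∀ j → c j ≡ 𝟎) → weight c ≡ 0
weight-𝟎 {zero}  c c≡𝟎 = refl
weight-𝟎 {suc n} c c≡𝟎 = cong₂ _+_ (cong weight₁ (c≡𝟎 zero)) (weight-𝟎 (tail c) (c≡𝟎 ∘ suc))

weight>0 : ∀ {n} (c : Word n) → NonZeroWord c → 0 < weight c
weight>0 {suc n} c (zero , c₀≢𝟎) = ≤-trans (≤-reflexive (sym (x≢𝟎⇒weight₁≡1 (c zero) c₀≢𝟎))) (m≤m+n _ _)
weight>0 {suc n} c (suc j , cⱼ≢𝟎) = ≤-trans (weight>0 (tail c) (j , cⱼ≢𝟎)) (m≤n+m _ _)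

weight-mono : ∀ {n} (u c : Word n) → (∀ j → u j ≢ 𝟎 → c j ≢ 𝟎) → weight u ≤ weight c
weight-mono {zero}  u c u⊆c = z≤n
weight-mono {suc n} u c u⊆c =
  +-mono-≤ (weight₁-mono (u zero) (c zero) (u⊆c zero)) (weight-mono (tail u) (tail c) (u⊆c ∘ suc))

StrictSuppSub⇒weight< : ∀ {n} (u c : Word n) → StrictSuppSub u c → weight u < weight c
StrictSuppSub⇒weight< {suc n} u c (u⊆c , zero , c₀≢𝟎 , u₀≡𝟎) =
  +-mono-<-≤ (subst (λ x → weight₁ x < weight₁ (c zero)) (sym u₀≡𝟎) (≤-reflexive (sym (x≢𝟎⇒weight₁≡1 (c zero) c₀≢𝟎))))
             (weight-mono (tail u) (tail c) (u⊆c ∘ suc))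
StrictSuppSub⇒weight< {suc n} u c (u⊆c , suc j , cⱼ≢𝟎 , uⱼ≡𝟎) =
  +-mono-≤-< (weight₁-mono (u zero) (c zero) (u⊆c zero))
             (StrictSuppSub⇒weight< (tail u) (tail c) (u⊆c ∘ suc , j , cⱼ≢𝟎 , uⱼ≡𝟎))

zero-or-nonzero : ∀ {n} (c : Word n) → (∀ j → c j ≡ 𝟎) ⊎ NonZeroWord c
zero-or-nonzero {n} c with Data.Fin.Properties.all? (λ j → c j ≟ 𝟎)
... | yes c≡𝟎 = inj₁ c≡𝟎
... | no  c≢𝟎 = inj₂ (¬∀⟶∃¬ n _ (λ j → c j ≟ 𝟎) c≢𝟎)

head≢𝟎 : ∀ {n} (c : Word (suc n)) → NonZeroWord c → (∀ j → tail c j ≡ 𝟎) → c zero ≢ 𝟎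
head≢𝟎 c (zero  , c₀≢𝟎) tail≡𝟎 = c₀≢𝟎
head≢𝟎 c (suc j , cⱼ≢𝟎) tail≡𝟎 = ⊥-elim (cⱼ≢𝟎 (tail≡𝟎 j))

-- Linear codes over F₄

infix 7 _·_

_·_ : ∀ {k} → Word k → Word k → F4
m · x = sumF4 (λ i → m i ⊗ x i)

sumF4-cong : ∀ {k} {f g : Word k} → (∀ i → f i ≡ g i) → sumF4 f ≡ sumF4 g
sumF4-cong {zero}  f≗g = refl
sumF4-cong {suc k} f≗g = cong₂ _⊕_ (f≗g zero) (sumF4-cong (f≗g ∘ suc))

sumF4-𝟎 : ∀ {k} (f : Word k) → (∀ i → f i ≡ 𝟎) → sumF4 f ≡ 𝟎
sumF4-𝟎 {zero}  f f≡𝟎 = refl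
sumF4-𝟎 {suc k} f f≡𝟎 = cong₂ _⊕_ (f≡𝟎 zero) (sumF4-𝟎 (tail f) (f≡𝟎 ∘ suc))

sumF4-⊕ : ∀ {k} (f g : Word k) → sumF4 (λ i → f i ⊕ g i) ≡ sumF4 f ⊕ sumF4 g
sumF4-⊕ {zero}  f g = refl
sumF4-⊕ {suc k} f g = trans (cong (f zero ⊕ g zero ⊕_) (sumF4-⊕ (tail f) (tail g)))
                            (⊕-interchange (f zero) (g zero) _ _)

sumF4-⊗ : ∀ {k} a (f : Word k) → sumF4 (λ i → a ⊗ f i) ≡ a ⊗ sumF4 f
sumF4-⊗ {zero}  a f = sym (⊗-zeroʳ a)
sumF4-⊗ {suc k} a f = trans (cong (a ⊗ f zero ⊕_) (sumF4-⊗ a (tail f))) (sym (⊗-distribˡ-⊕ a _ _))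

sumF4-punchIn : ∀ {k} (p : Fin (suc k)) (f : Word (suc k)) → sumF4 f ≡ f p ⊕ sumF4 (f ∘ punchIn p)
sumF4-punchIn         zero    f = refl
sumF4-punchIn {suc k} (suc p) f =
  trans (cong (f zero ⊕_) (sumF4-punchIn p (tail f))) (⊕-left-comm (f zero) (f (suc p)) _)

·-comm : ∀ {k} (m x : Word k) → m · x ≡ x · m
·-comm m x = sumF4-cong (λ i → ⊗-comm (m i) (x i))

·-zeroˡ : ∀ {k} (m x : Word k) → (∀ i → m i ≡ 𝟎) → m · x ≡ 𝟎
·-zeroˡ m x m≡𝟎 = sumF4-𝟎 _ (λ i → cong (_⊗ x i) (m≡𝟎 i))

module _ {k n} (G : GenMatrix k n) where

  encode-linear : ∀ (p q : Word k) a j → encode G (λ i → p i ⊕ a ⊗ q i) j ≡ encode G p j ⊕ a ⊗ encode G q j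
  encode-linear p q a j = begin
    sumF4 (λ i → (p i ⊕ a ⊗ q i) ⊗ G i j)
      ≡⟨ sumF4-cong (λ i → trans (⊗-distribʳ-⊕ (G i j) (p i) _) (cong (p i ⊗ G i j ⊕_) (⊗-assoc a (q i) (G i j)))) ⟩
    sumF4 (λ i → p i ⊗ G i j ⊕ a ⊗ (q i ⊗ G i j))
      ≡⟨ sumF4-⊕ (λ i → p i ⊗ G i j) (λ i → a ⊗ (q i ⊗ G i j)) ⟩
    encode G p j ⊕ sumF4 (λ i → a ⊗ (q i ⊗ G i j))
      ≡⟨ cong (encode G p j ⊕_) (sumF4-⊗ a (λ i → q i ⊗ G i j)) ⟩
    encode G p j ⊕ a ⊗ encode G q j
      ∎
    where open ≡-Reasoning

  encode-scale : ∀ (m : Word k) a j → encode G (λ i → a ⊗ m i) j ≡ a ⊗ encode G m j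
  encode-scale m a j = trans (sumF4-cong (λ i → ⊗-assoc a (m i) (G i j))) (sumF4-⊗ a (λ i → m i ⊗ G i j))

  ∈C-linear : ∀ {x y : Word n} → x ∈C G → y ∈C G → ∀ a → (λ j → x j ⊕ a ⊗ y j) ∈C G
  ∈C-linear (mx , x≗) (my , y≗) a =
    (λ i → mx i ⊕ a ⊗ my i) , λ j → trans (cong₂ (λ u v → u ⊕ a ⊗ v) (x≗ j) (y≗ j)) (sym (encode-linear mx my a j))

  encode-injective : LinIndep G → ∀ (x y : Word k) → (∀ j → encode G x j ≡ encode G y j) → ∀ i → x i ≡ y i
  encode-injective indep x y x≗y i = x⊕y≡𝟎⇒x≡y (x i) (y i) (indep (λ i → x i ⊕ 𝟏 ⊗ y i)
    (λ j → trans (encode-linear x y 𝟏 j) (trans (cong (_⊕ encode G y j) (x≗y j)) (⊕-self (encode G y j)))) i)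

  encode-nonzero : LinIndep G → ∀ (m : Word k) → NonZeroWord m → NonZeroWord (encode G m)
  encode-nonzero indep m (i , mᵢ≢𝟎) =
    ¬∀⟶∃¬ n _ (λ j → encode G m j ≟ 𝟎) (λ encode≡𝟎 → mᵢ≢𝟎 (indep m encode≡𝟎 i))

encode-punchIn : ∀ {k n} (G : GenMatrix (suc k) n) p (m : Word k) j →
  encode (G ∘ punchIn p) m j ≡ encode G (insertAt m p 𝟎) j
encode-punchIn G p m j = sym (begin
  encode G (insertAt m p 𝟎) j
    ≡⟨ sumF4-punchIn p (λ i → insertAt m p 𝟎 i ⊗ G i j) ⟩
  insertAt m p 𝟎 p ⊗ G p j ⊕ sumF4 (λ i → insertAt m p 𝟎 (punchIn p i) ⊗ G (punchIn p i) j)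
    ≡⟨ cong (λ z → z ⊗ G p j ⊕ sumF4 (λ i → insertAt m p 𝟎 (punchIn p i) ⊗ G (punchIn p i) j)) (insertAt-lookup m p 𝟎) ⟩
  sumF4 (λ i → insertAt m p 𝟎 (punchIn p i) ⊗ G (punchIn p i) j)
    ≡⟨ sumF4-cong (λ i → cong (_⊗ G (punchIn p i) j) (insertAt-punchIn m p 𝟎 i)) ⟩
  encode (G ∘ punchIn p) m j
    ∎)
  where open ≡-Reasoning

-- Sums over F₄ᵏ

vectors : ∀ k → Vector (Word k) (4 ^ k)
vectors zero    = [] ∷ []
vectors (suc k) = map (𝟎 ∷_) (vectors k) ++ (map (𝟏 ∷_) (vectors k) ++
                 (map (ω ∷_) (vectors k) ++ (map (ω² ∷_) (vectors k) ++ [])))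

∑ᵛ : ∀ k → (Word k → ℕ) → ℕ
∑ᵛ k f = sum (map f (vectors k))

∑ᵛ-suc : ∀ k (f : Word (suc k) → ℕ) → ∑ᵛ (suc k) f ≡ ∑F4 (λ a → ∑ᵛ k (λ x → f (a ∷ x)))
∑ᵛ-suc k f =
  trans (sum-map-++ f (map (𝟎 ∷_) (vectors k)) _) (cong (∑ᵛ k (f ∘ (𝟎 ∷_)) +_)
  (trans (sum-map-++ f (map (𝟏 ∷_) (vectors k)) _) (cong (∑ᵛ k (f ∘ (𝟏 ∷_)) +_)
  (trans (sum-map-++ f (map (ω ∷_) (vectors k)) _) (cong (∑ᵛ k (f ∘ (ω ∷_)) +_)
  (sum-map-++ f (map (ω² ∷_) (vectors k)) []))))))

∑ᵛ-cong : ∀ k {f g : Word k → ℕ} → (∀ x → f x ≡ g x) → ∑ᵛ k f ≡ ∑ᵛ k g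
∑ᵛ-cong k f≗g = sum-cong-≗ (f≗g ∘ vectors k)

∑ᵛ-const : ∀ k y → ∑ᵛ k (λ _ → y) ≡ 4 ^ k * y
∑ᵛ-const k y = sum-const (4 ^ k) y

∑ᵛ-lower : ∀ k d (f : Word k → ℕ) → (∀ x → d ≤ f x) → 4 ^ k * d ≤ ∑ᵛ k f
∑ᵛ-lower k d f d≤f = ≤-trans (≤-reflexive (sym (∑ᵛ-const k d))) (sum-mono-≤ (d≤f ∘ vectors k))

-- The zero vector is the only one that may violate the bound.
∑ᵛ-lower-nonzero : ∀ k d (f : Word k → ℕ) → (∀ x → NonZeroWord x → d ≤ f x) → 4 ^ k * d ≤ ∑ᵛ k f + d
∑ᵛ-lower-nonzero zero    d f d≤f = ≤-trans (≤-reflexive (*-identityˡ d)) (m≤n+m d _)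
∑ᵛ-lower-nonzero (suc k) d f d≤f = begin
  4 ^ suc k * d
    ≡⟨ *-assoc 4 (4 ^ k) d ⟩
  y + (y + (y + (y + 0)))
    ≤⟨ +-mono-≤ (∑ᵛ-lower-nonzero k d (f ∘ (𝟎 ∷_)) (λ x x≢𝟎 → d≤f _ (suc (proj₁ x≢𝟎) , proj₂ x≢𝟎)))
                (+-mono-≤ (block 𝟏 λ ()) (+-mono-≤ (block ω λ ()) (+-monoˡ-≤ 0 (block ω² λ ())))) ⟩
  (A 𝟎 + d) + (A 𝟏 + (A ω + (A ω² + 0)))
    ≡⟨ swap (A 𝟎) d (A 𝟏 + (A ω + (A ω² + 0))) ⟩
  ∑F4 A + d
    ≡⟨ cong (_+ d) (sym (∑ᵛ-suc k f)) ⟩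
  ∑ᵛ (suc k) f + d
    ∎
  where
  open ≤-Reasoning
  y = 4 ^ k * d
  A : F4 → ℕ
  A a = ∑ᵛ k (λ x → f (a ∷ x))
  block : ∀ a → a ≢ 𝟎 → y ≤ A a
  block a a≢𝟎 = ∑ᵛ-lower k d _ (λ x → d≤f (a ∷ x) (zero , a≢𝟎))
  swap : ∀ a b c → (a + b) + c ≡ (a + c) + b
  swap = solve-∀

-- As s ⊕ a · x ≡ 𝟎 iff a · x ≡ s, this says that a nonzero linear form takes each value 4ᵏ⁻¹ times.
linear-form-fibre : ∀ k (a : Word k) → NonZeroWord a → ∀ s → 4 * ∑ᵛ k (λ x → δ₀ (s ⊕ a · x)) ≡ 4 ^ k
linear-form-fibre (suc k) a a≢𝟎 s = begin
  4 * ∑ᵛ (suc k) (λ x → δ₀ (s ⊕ a · x))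
    ≡⟨ cong (4 *_) (∑ᵛ-suc k (λ x → δ₀ (s ⊕ a · x))) ⟩
  4 * ∑F4 (λ b → ∑ᵛ k (λ x → δ₀ (s ⊕ (a zero ⊗ b ⊕ tail a · x))))
    ≡⟨ cong (4 *_) (∑F4-cong λ b → ∑ᵛ-cong k λ x → cong δ₀ (sym (⊕-assoc s (a zero ⊗ b) (tail a · x)))) ⟩
  4 * ∑F4 fibre
    ≡⟨ cong (4 *_) (∑F4-fibre (zero-or-nonzero (tail a))) ⟩
  4 ^ suc k
    ∎
  where
  open ≡-Reasoning
  t : F4 → F4
  t b = s ⊕ a zero ⊗ b
  fibre : F4 → ℕ
  fibre b = ∑ᵛ k (λ x → δ₀ (t b ⊕ tail a · x))
  ∑F4-fibre : (∀ i → tail a i ≡ 𝟎) ⊎ NonZeroWord (tail a) → ∑F4 fibre ≡ 4 ^ k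
  ∑F4-fibre (inj₂ tail≢𝟎) = ∑F4-quarter fibre (4 ^ k) (λ b → linear-form-fibre k (tail a) tail≢𝟎 (t b))
  ∑F4-fibre (inj₁ tail≡𝟎) = begin
    ∑F4 fibre
      ≡⟨ ∑F4-cong (λ b → ∑ᵛ-cong k λ x → cong (λ z → δ₀ (t b ⊕ z)) (·-zeroˡ (tail a) x tail≡𝟎)) ⟩
    ∑F4 (λ b → ∑ᵛ k (λ _ → δ₀ (t b ⊕ 𝟎)))
      ≡⟨ ∑F4-cong (λ b → trans (∑ᵛ-const k (δ₀ (t b ⊕ 𝟎))) (cong (λ z → 4 ^ k * δ₀ z) (⊕-identityʳ (t b)))) ⟩
    ∑F4 (λ b → 4 ^ k * δ₀ (t b))
      ≡⟨ sym (*-distribˡ-sum (4 ^ k) (λ i → δ₀ (t (elements i)))) ⟩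
    4 ^ k * ∑F4 (λ b → δ₀ (t b))
      ≡⟨ cong (4 ^ k *_) (∑F4-solution (a zero) s (head≢𝟎 a a≢𝟎 tail≡𝟎)) ⟩
    4 ^ k * 1
      ≡⟨ *-identityʳ _ ⟩
    4 ^ k
      ∎

linear-form-weight : ∀ k (a : Word k) → NonZeroWord a → ∀ s → 4 * ∑ᵛ k (λ x → weight₁ (s ⊕ a · x)) ≡ 3 * 4 ^ k
linear-form-weight k a a≢𝟎 s = +-cancelʳ-≡ (4 ^ k) _ _ (begin
  4 * W + 4 ^ k
    ≡⟨ cong (4 * W +_) (sym (linear-form-fibre k a a≢𝟎 s)) ⟩
  4 * W + 4 * Z
    ≡⟨ sym (*-distribˡ-+ 4 W Z) ⟩
  4 * (W + Z)
    ≡⟨ cong (4 *_) (sym (∑-distrib-+ (λ i → weight₁ (s ⊕ a · vectors k i)) (λ i → δ₀ (s ⊕ a · vectors k i)))) ⟩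
  4 * ∑ᵛ k (λ x → weight₁ (s ⊕ a · x) + δ₀ (s ⊕ a · x))
    ≡⟨ cong (4 *_) (trans (∑ᵛ-cong k (λ x → weight₁+δ₀≡1 (s ⊕ a · x))) (∑ᵛ-const k 1)) ⟩
  4 * (4 ^ k * 1)
    ≡⟨ solve (4 ^ k) ⟩
  3 * 4 ^ k + 4 ^ k
    ∎)
  where
  open ≡-Reasoning
  W = ∑ᵛ k (λ x → weight₁ (s ⊕ a · x))
  Z = ∑ᵛ k (λ x → δ₀ (s ⊕ a · x))
  solve : ∀ y → 4 * (y * 1) ≡ 3 * y + y
  solve = solve-∀

-- Every nonzero column is nonzero in exactly 3/4 of the codewords.
weight-∑ᵛ : ∀ {k n} (G : GenMatrix k n) → 4 * ∑ᵛ k (λ m → weight (encode G m)) ≤ n * (3 * 4 ^ k)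
weight-∑ᵛ {k} {n} G = begin
  4 * ∑ᵛ k (λ m → weight (encode G m))                    ≡⟨ cong (4 *_) (∑ᵛ-cong k (λ m → weight≡sum (encode G m))) ⟩
  4 * ∑ᵛ k (λ m → sum (λ j → weight₁ (encode G m j)))     ≡⟨ cong (4 *_) (∑-comm (λ i j → weight₁ (encode G (vectors k i) j))) ⟩
  4 * sum (λ j → ∑ᵛ k (λ m → weight₁ (encode G m j)))     ≤⟨ sum-bound _ _ (λ j → column (λ i → G i j)) ⟩
  n * (3 * 4 ^ k)                                         ∎
  where
  open ≤-Reasoning
  column : ∀ a → 4 * ∑ᵛ k (λ m → weight₁ (m · a)) ≤ 3 * 4 ^ k
  column a with zero-or-nonzero a
  ... | inj₁ a≡𝟎 = ≤-trans (≤-reflexive (cong (4 *_) (trans (∑ᵛ-cong k (λ m →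
                      cong weight₁ (trans (·-comm m a) (·-zeroˡ a m a≡𝟎)))) (trans (∑ᵛ-const k 0) (*-zeroʳ (4 ^ k)))))) z≤n
  ... | inj₂ a≢𝟎 = ≤-reflexive (trans (cong (4 *_) (∑ᵛ-cong k (λ m → cong weight₁ (·-comm m a))))
                                       (linear-form-weight k a a≢𝟎 𝟎))

-- The simplex code

simplexLength : ℕ → ℕ
simplexLength zero    = 0
simplexLength (suc k) = 4 ^ k + simplexLength k

-- One column for each point of PG(k-1, 4): the vectors whose first nonzero entry is 1.
simplexColumns : ∀ k → Vector (Word k) (simplexLength k)
simplexColumns zero    = []
simplexColumns (suc k) = map (𝟏 ∷_) (vectors k) ++ map (𝟎 ∷_) (simplexColumns k)

simplex : ∀ k → GenMatrix k (simplexLength k)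
simplex k i j = simplexColumns k j i

simplexLength≡ : ∀ k → simplexLength k ≡ (4 ^ k ∸ 1) / 3
simplexLength≡ k = sym (begin
  (4 ^ k ∸ 1) / 3                    ≡⟨ cong (λ x → (x ∸ 1) / 3) (sym (count k)) ⟩
  (simplexLength k * 3 + 1 ∸ 1) / 3  ≡⟨ cong (_/ 3) (m+n∸n≡m (simplexLength k * 3) 1) ⟩
  simplexLength k * 3 / 3            ≡⟨ m*n/n≡m _ 3 ⟩
  simplexLength k                    ∎)
  where
  open ≡-Reasoning
  count : ∀ k → simplexLength k * 3 + 1 ≡ 4 ^ k
  count zero    = refl
  count (suc k) = trans (step (4 ^ k) (simplexLength k)) (trans (cong (4 ^ k * 3 +_) (count k)) (solve (4 ^ k)))
    where
    step : ∀ a b → (a + b) * 3 + 1 ≡ a * 3 + (b * 3 + 1)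
    step = solve-∀
    solve : ∀ a → a * 3 + a ≡ 4 * a
    solve = solve-∀

simplex-weight-suc : ∀ k (m : Word (suc k)) →
  weight (encode (simplex (suc k)) m) ≡ ∑ᵛ k (λ x → weight₁ (m zero ⊕ tail m · x)) + weight (encode (simplex k) (tail m))
simplex-weight-suc k m = begin
  weight (encode (simplex (suc k)) m)
    ≡⟨ weight≡sum (encode (simplex (suc k)) m) ⟩
  sum (map (λ x → weight₁ (m · x)) (simplexColumns (suc k)))
    ≡⟨ sum-map-++ (λ x → weight₁ (m · x)) (map (𝟏 ∷_) (vectors k)) (map (𝟎 ∷_) (simplexColumns k)) ⟩
  ∑ᵛ k (λ x → weight₁ (m zero ⊗ 𝟏 ⊕ tail m · x)) + sum (map (λ x → weight₁ (m zero ⊗ 𝟎 ⊕ tail m · x)) (simplexColumns k))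
    ≡⟨ cong₂ _+_ (∑ᵛ-cong k (λ x → cong (λ z → weight₁ (z ⊕ tail m · x)) (⊗-identityʳ (m zero))))
                 (sum-cong-≗ (λ j → cong (λ z → weight₁ (z ⊕ tail m · simplexColumns k j)) (⊗-zeroʳ (m zero)))) ⟩
  ∑ᵛ k (λ x → weight₁ (m zero ⊕ tail m · x)) + sum (map (λ x → weight₁ (tail m · x)) (simplexColumns k))
    ≡⟨ cong (∑ᵛ k (λ x → weight₁ (m zero ⊕ tail m · x)) +_) (sym (weight≡sum (encode (simplex k) (tail m)))) ⟩
  ∑ᵛ k (λ x → weight₁ (m zero ⊕ tail m · x)) + weight (encode (simplex k) (tail m))
    ∎
  where open ≡-Reasoning

simplex-weight : ∀ k (m : Word (suc k)) → NonZeroWord m → weight (encode (simplex (suc k)) m) ≡ 4 ^ k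
simplex-weight k m m≢𝟎 with zero-or-nonzero (tail m)
... | inj₁ tail≡𝟎 = begin
  weight (encode (simplex (suc k)) m)
    ≡⟨ simplex-weight-suc k m ⟩
  ∑ᵛ k (λ x → weight₁ (m zero ⊕ tail m · x)) + weight (encode (simplex k) (tail m))
    ≡⟨ cong₂ _+_ (∑ᵛ-cong k (λ x → cong (λ z → weight₁ (m zero ⊕ z)) (·-zeroˡ (tail m) x tail≡𝟎)))
                 (weight-𝟎 (encode (simplex k) (tail m)) (λ j → ·-zeroˡ (tail m) (simplexColumns k j) tail≡𝟎)) ⟩
  ∑ᵛ k (λ _ → weight₁ (m zero ⊕ 𝟎)) + 0
    ≡⟨ trans (+-identityʳ _) (∑ᵛ-const k _) ⟩
  4 ^ k * weight₁ (m zero ⊕ 𝟎)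
    ≡⟨ cong (4 ^ k *_) (trans (cong weight₁ (⊕-identityʳ (m zero))) (x≢𝟎⇒weight₁≡1 (m zero) (head≢𝟎 m m≢𝟎 tail≡𝟎))) ⟩
  4 ^ k * 1
    ≡⟨ *-identityʳ _ ⟩
  4 ^ k
    ∎
  where open ≡-Reasoning
simplex-weight (suc k) m m≢𝟎 | inj₂ tail≢𝟎 = *-cancelˡ-≡ _ _ 4 (begin
  4 * weight (encode (simplex (suc (suc k))) m)
    ≡⟨ cong (4 *_) (simplex-weight-suc (suc k) m) ⟩
  4 * (W + weight (encode (simplex (suc k)) (tail m)))
    ≡⟨ cong (λ z → 4 * (W + z)) (simplex-weight k (tail m) tail≢𝟎) ⟩
  4 * (W + 4 ^ k)
    ≡⟨ *-distribˡ-+ 4 W _ ⟩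
  4 * W + 4 * 4 ^ k
    ≡⟨ cong (_+ 4 * 4 ^ k) (linear-form-weight (suc k) (tail m) tail≢𝟎 (m zero)) ⟩
  3 * 4 ^ suc k + 4 * 4 ^ k
    ≡⟨ solve (4 ^ k) ⟩
  4 * 4 ^ suc k
    ∎)
  where
  open ≡-Reasoning
  W = ∑ᵛ (suc k) (λ x → weight₁ (m zero ⊕ tail m · x))
  solve : ∀ y → 3 * (4 * y) + 4 * y ≡ 4 * (4 * y)
  solve = solve-∀

simplex-codeword-weight : ∀ k c → c ∈C simplex (suc k) → NonZeroWord c → weight c ≡ 4 ^ k
simplex-codeword-weight k c (m , c≗) (j , cⱼ≢𝟎) with zero-or-nonzero m
... | inj₁ m≡𝟎 = ⊥-elim (cⱼ≢𝟎 (trans (c≗ j) (·-zeroˡ m (simplexColumns (suc k) j) m≡𝟎)))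
... | inj₂ m≢𝟎 = trans (weight-cong c≗) (simplex-weight k m m≢𝟎)

constant-weight⇒minimal : ∀ {k n} (G : GenMatrix k n) w →
  (∀ c → c ∈C G → NonZeroWord c → weight c ≡ w) → IsMinimalCode G
constant-weight⇒minimal G w weight≡w c u c∈G c≢𝟎 u∈G u≢𝟎 u⊂c =
  <⇒≢ (StrictSuppSub⇒weight< u c u⊂c) (trans (weight≡w u u∈G u≢𝟎) (sym (weight≡w c c∈G c≢𝟎)))

simplex-indep : ∀ k → LinIndep (simplex (suc k))
simplex-indep k m encode≡𝟎 i with zero-or-nonzero m
... | inj₁ m≡𝟎 = m≡𝟎 i
... | inj₂ m≢𝟎 = ⊥-elim (<⇒≢ (m^n>0 4 k) (sym (trans (sym (simplex-weight k m m≢𝟎)) (weight-𝟎 _ encode≡𝟎))))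

-- Divisible minimal codes

residue-unique : ∀ {d x y p q} → d ∣ x → d ∣ y → x + p ≡ y + q → p < d → q < d → p ≡ q
residue-unique {suc d} {x} {y} {p} {q} (divides a x≡) (divides b y≡) x+p≡y+q p<d q<d = begin
  p                     ≡⟨ sym (m<n⇒m%n≡m p<d) ⟩
  p % suc d             ≡⟨ sym ([m+kn]%n≡m%n p a (suc d)) ⟩
  (p + a * suc d) % suc d ≡⟨ cong (_% suc d) (trans (+-comm p _) (trans (cong (_+ p) (sym x≡))
                              (trans x+p≡y+q (trans (cong (_+ q) y≡) (+-comm _ q))))) ⟩
  (q + b * suc d) % suc d ≡⟨ [m+kn]%n≡m%n q b (suc d) ⟩
  q % suc d             ≡⟨ m<n⇒m%n≡m q<d ⟩
  q                     ∎
  where open ≡-Reasoning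

minimal⇒supports-meet : ∀ {k n} (G : GenMatrix k n) {c v : Word n} → IsMinimalCode G →
  c ∈C G → v ∈C G → NonZeroWord c → NonZeroWord v → ¬ (∀ j → c j ≢ 𝟎 → v j ≡ 𝟎)
minimal⇒supports-meet G {c} {v} minimal c∈G v∈G (j₀ , c₀≢𝟎) v≢𝟎 disjoint =
  minimal (λ j → c j ⊕ v j) v (∈C-linear G c∈G v∈G 𝟏) (j₀ , c+v₀≢𝟎) v∈G v≢𝟎 (v⊆c+v , j₀ , c+v₀≢𝟎 , disjoint j₀ c₀≢𝟎)
  where
  c+v₀≢𝟎 : c j₀ ⊕ v j₀ ≢ 𝟎
  c+v₀≢𝟎 c+v≡𝟎 = c₀≢𝟎 (trans (sym (⊕-identityʳ _)) (trans (cong (c j₀ ⊕_) (sym (disjoint j₀ c₀≢𝟎))) c+v≡𝟎))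
  v⊆c+v : ∀ j → v j ≢ 𝟎 → c j ⊕ v j ≢ 𝟎
  v⊆c+v j vⱼ≢𝟎 with c j ≟ 𝟎
  ... | yes cⱼ≡𝟎 = subst (λ z → z ⊕ v j ≢ 𝟎) (sym cⱼ≡𝟎) vⱼ≢𝟎
  ... | no  cⱼ≢𝟎 = ⊥-elim (vⱼ≢𝟎 (disjoint j cⱼ≢𝟎))

-- hits μ c w s counts, with multiplicity μ, the positions j with w j = s c j.
hits : ∀ {n} → Vector ℕ n → Word n → Word n → F4 → ℕ
hits μ c w s = sum (λ j → μ j * δ₀ (w j ⊕ s ⊗ c j))

Equidistributed : ∀ {r n} → Word n → GenMatrix r n → Vector ℕ n → Set
Equidistributed c U μ = ∀ m → NonZeroWord m → ∀ s → 4 * hits μ c (encode U m) s ≡ sum μ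

weight-shift : ∀ {n} (c w : Word n) a →
  weight (λ j → w j ⊕ a ⊗ c j) + hits (weight₁ ∘ c) c w a ≡ sum (λ j → δ₀ (c j) * weight₁ (w j)) + weight c
weight-shift c w a = begin
  weight (λ j → w j ⊕ a ⊗ c j) + hits (weight₁ ∘ c) c w a
    ≡⟨ cong (_+ hits (weight₁ ∘ c) c w a) (weight≡sum (λ j → w j ⊕ a ⊗ c j)) ⟩
  sum (λ j → weight₁ (w j ⊕ a ⊗ c j)) + hits (weight₁ ∘ c) c w a
    ≡⟨ sym (∑-distrib-+ (λ j → weight₁ (w j ⊕ a ⊗ c j)) (λ j → weight₁ (c j) * δ₀ (w j ⊕ a ⊗ c j))) ⟩
  sum (λ j → weight₁ (w j ⊕ a ⊗ c j) + weight₁ (c j) * δ₀ (w j ⊕ a ⊗ c j))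
    ≡⟨ sum-cong-≗ (λ j → weight₁-shift (w j) (c j) a) ⟩
  sum (λ j → δ₀ (c j) * weight₁ (w j) + weight₁ (c j))
    ≡⟨ ∑-distrib-+ (λ j → δ₀ (c j) * weight₁ (w j)) (λ j → weight₁ (c j)) ⟩
  sum (λ j → δ₀ (c j) * weight₁ (w j)) + sum (λ j → weight₁ (c j))
    ≡⟨ cong (sum (λ j → δ₀ (c j) * weight₁ (w j)) +_) (sym (weight≡sum c)) ⟩
  sum (λ j → δ₀ (c j) * weight₁ (w j)) + weight c
    ∎
  where open ≡-Reasoning

∑F4-hits : ∀ {n} (c w : Word n) → ∑F4 (hits (weight₁ ∘ c) c w) ≡ weight c
∑F4-hits c w = begin
  ∑F4 (hits (weight₁ ∘ c) c w)
    ≡⟨ ∑-comm (λ i j → weight₁ (c j) * δ₀ (w j ⊕ elements i ⊗ c j)) ⟩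
  sum (λ j → ∑F4 (λ a → weight₁ (c j) * δ₀ (w j ⊕ a ⊗ c j)))
    ≡⟨ sum-cong-≗ (λ j → ∑F4-multiple (w j) (c j)) ⟩
  sum (λ j → weight₁ (c j))
    ≡⟨ sym (weight≡sum c) ⟩
  weight c
    ∎
  where open ≡-Reasoning

hits<weight : ∀ {k n} (G : GenMatrix k n) {c w : Word n} → IsMinimalCode G →
  c ∈C G → NonZeroWord c → w ∈C G → (∀ a → ¬ (∀ j → w j ≡ a ⊗ c j)) → ∀ a → hits (weight₁ ∘ c) c w a < weight c
hits<weight {n = n} G {c} {w} minimal c∈G c≢𝟎 w∈G w∉⟨c⟩ a = ≤∧≢⇒< hits≤weight hits≢weight
  where
  bounded : ∀ j → weight₁ (c j) * δ₀ (w j ⊕ a ⊗ c j) ≤ weight₁ (c j)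
  bounded j = weight₁*δ₀≤weight₁ (c j) (w j ⊕ a ⊗ c j)
  hits≤weight : hits (weight₁ ∘ c) c w a ≤ weight c
  hits≤weight = subst (hits (weight₁ ∘ c) c w a ≤_) (sym (weight≡sum c)) (sum-mono-≤ bounded)
  w+ac≢𝟎 : NonZeroWord (λ j → w j ⊕ a ⊗ c j)
  w+ac≢𝟎 = let j , wⱼ≢acⱼ = ¬∀⟶∃¬ n _ (λ j → w j ≟ a ⊗ c j) (w∉⟨c⟩ a)
           in j , wⱼ≢acⱼ ∘ x⊕y≡𝟎⇒x≡y (w j) (a ⊗ c j)
  hits≢weight : hits (weight₁ ∘ c) c w a ≢ weight c
  hits≢weight hits≡weight = minimal⇒supports-meet G minimal c∈G (∈C-linear G w∈G c∈G a) c≢𝟎 w+ac≢𝟎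
    (λ j cⱼ≢𝟎 → weight₁*δ₀≡weight₁ (c j) (w j ⊕ a ⊗ c j) (saturated j) cⱼ≢𝟎)
    where saturated = sum-≤-≡⇒≗ bounded (trans hits≡weight (weight≡sum c))

-- The counts agree modulo Δ (divisibility) and are below Δ (minimality), hence are all equal.
equidistributed : ∀ {k n Δ} (G : GenMatrix k n) {c w : Word n} → IsMinimalCode G → IsDivisible Δ G →
  c ∈C G → NonZeroWord c → weight c ≡ Δ → w ∈C G → (∀ a → ¬ (∀ j → w j ≡ a ⊗ c j)) →
  ∀ s → 4 * hits (weight₁ ∘ c) c w s ≡ Δ
equidistributed {Δ = Δ} G {c} {w} minimal divisible c∈G c≢𝟎 weight≡Δ w∈G w∉⟨c⟩ s = begin
  4 * N s           ≡⟨⟩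
  ∑F4 (λ _ → N s)   ≡⟨ ∑F4-cong (λ a → N-constant s a) ⟩
  ∑F4 N             ≡⟨ ∑F4-hits c w ⟩
  weight c          ≡⟨ weight≡Δ ⟩
  Δ                 ∎
  where
  open ≡-Reasoning
  N : F4 → ℕ
  N = hits (weight₁ ∘ c) c w
  N<Δ : ∀ a → N a < Δ
  N<Δ a = subst (N a <_) weight≡Δ (hits<weight G minimal c∈G c≢𝟎 w∈G w∉⟨c⟩ a)
  N-constant : ∀ a b → N a ≡ N b
  N-constant a b = residue-unique (divisible _ (∈C-linear G w∈G c∈G a)) (divisible _ (∈C-linear G w∈G c∈G b))
                     (trans (weight-shift c w a) (sym (weight-shift c w b))) (N<Δ a) (N<Δ b)

restrict : ∀ {r n} → GenMatrix (suc r) n → Vector ℕ n → Vector ℕ n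
restrict U μ j = μ j * δ₀ (U zero j)

δ₀-split-scaled : ∀ μ u x t →
  μ * δ₀ u + ∑F4 (λ a → μ * δ₀ ((a ⊗ u ⊕ x) ⊕ t)) ≡ μ + 4 * (μ * δ₀ u * δ₀ (x ⊕ t))
δ₀-split-scaled μ u x t = begin
  μ * δ₀ u + ∑F4 (λ a → μ * δ₀ ((a ⊗ u ⊕ x) ⊕ t))
    ≡⟨ cong (μ * δ₀ u +_) (sym (*-distribˡ-sum μ (λ i → δ₀ ((elements i ⊗ u ⊕ x) ⊕ t)))) ⟩
  μ * δ₀ u + μ * ∑F4 (λ a → δ₀ ((a ⊗ u ⊕ x) ⊕ t))
    ≡⟨ sym (*-distribˡ-+ μ _ _) ⟩
  μ * (δ₀ u + ∑F4 (λ a → δ₀ ((a ⊗ u ⊕ x) ⊕ t)))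
    ≡⟨ cong (μ *_) (δ₀-split u x t) ⟩
  μ * (1 + 4 * (δ₀ u * δ₀ (x ⊕ t)))
    ≡⟨ expand μ (δ₀ u) (δ₀ (x ⊕ t)) ⟩
  μ + 4 * (μ * δ₀ u * δ₀ (x ⊕ t))
    ∎
  where
  open ≡-Reasoning
  expand : ∀ a b d → a * (1 + 4 * (b * d)) ≡ a + 4 * (a * b * d)
  expand = solve-∀

restrict-quarter : ∀ {r n} (c : Word n) (U : GenMatrix (suc r) n) μ → Equidistributed c U μ →
  4 * sum (restrict U μ) ≡ sum μ
restrict-quarter c U μ equi =
  trans (cong (4 *_) (sum-cong-≗ λ j → cong (λ z → μ j * δ₀ z) (sym (e₀-coordinate j))))
        (equi (𝟏 ∷ (λ _ → 𝟎)) (zero , λ ()) 𝟎)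
  where
  e₀-coordinate : ∀ j → encode U (𝟏 ∷ (λ _ → 𝟎)) j ⊕ 𝟎 ⊗ c j ≡ U zero j
  e₀-coordinate j = trans (⊕-identityʳ _)
    (trans (cong (U zero j ⊕_) (sumF4-𝟎 (λ i → 𝟎 ⊗ U (suc i) j) (λ _ → refl))) (⊕-identityʳ (U zero j)))

restrict-equidistributed : ∀ {r n} (c : Word n) (U : GenMatrix (suc r) n) μ → Equidistributed c U μ →
  Equidistributed c (U ∘ suc) (restrict U μ)
restrict-equidistributed c U μ equi m (i , mᵢ≢𝟎) s = sym (+-cancelˡ-≡ (sum μ) _ _ (begin
  sum μ + sum μ′                                 ≡⟨ cong (_+ sum μ′) (sym ∑F4-lifts) ⟩
  ∑F4 lift + sum μ′                              ≡⟨ +-comm (∑F4 lift) (sum μ′) ⟩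
  sum μ′ + ∑F4 lift                              ≡⟨ cong (sum μ′ +_) (∑-comm (λ a j → term (elements a) j)) ⟩
  sum μ′ + sum (λ j → ∑F4 (λ a → term a j))      ≡⟨ sym (∑-distrib-+ μ′ (λ j → ∑F4 (λ a → term a j))) ⟩
  sum (λ j → μ′ j + ∑F4 (λ a → term a j))        ≡⟨ sum-cong-≗ (λ j → δ₀-split-scaled (μ j) (U zero j) (x j) (s ⊗ c j)) ⟩
  sum (λ j → μ j + 4 * (μ′ j * δ₀ (x j ⊕ s ⊗ c j)))
                                                 ≡⟨ ∑-distrib-+ μ (λ j → 4 * (μ′ j * δ₀ (x j ⊕ s ⊗ c j))) ⟩
  sum μ + sum (λ j → 4 * (μ′ j * δ₀ (x j ⊕ s ⊗ c j)))
                                                 ≡⟨ cong (sum μ +_) (sym (*-distribˡ-sum 4 (λ j → μ′ j * δ₀ (x j ⊕ s ⊗ c j)))) ⟩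
  sum μ + 4 * hits μ′ c x s                      ∎))
  where
  open ≡-Reasoning
  μ′ = restrict U μ
  x = encode (U ∘ suc) m
  lift : F4 → ℕ
  lift a = hits μ c (encode U (a ∷ m)) s
  term : F4 → Fin _ → ℕ
  term a j = μ j * δ₀ ((a ⊗ U zero j ⊕ x j) ⊕ s ⊗ c j)
  ∑F4-lifts : ∑F4 lift ≡ sum μ
  ∑F4-lifts = ∑F4-quarter lift (sum μ) (λ a → equi (a ∷ m) (suc i , mᵢ≢𝟎) s)

equidistributed⇒4^r∣ : ∀ {n} r (c : Word n) (U : GenMatrix r n) μ → Equidistributed c U μ → 4 ^ r ∣ sum μ
equidistributed⇒4^r∣ zero    c U μ equi = 1∣ sum μ
equidistributed⇒4^r∣ (suc r) c U μ equi =
  subst (4 ^ suc r ∣_) (restrict-quarter c U μ equi)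
    (*-monoʳ-∣ 4 (equidistributed⇒4^r∣ r c (U ∘ suc) (restrict U μ) (restrict-equidistributed c U μ equi)))

weight≡Δ⇒4^k∣Δ : ∀ {k n Δ} (G : GenMatrix (suc k) n) → LinIndep G → IsMinimalCode G → IsDivisible Δ G →
  ∀ m → NonZeroWord m → weight (encode G m) ≡ Δ → 4 ^ k ∣ Δ
weight≡Δ⇒4^k∣Δ {k} {n} {Δ} G indep minimal divisible m (p , mₚ≢𝟎) weight≡Δ =
  subst (4 ^ k ∣_) (sym Δ≡∑μ) (equidistributed⇒4^r∣ k c U (weight₁ ∘ c) λ m′ m′≢𝟎 s →
    trans (equidistributed G minimal divisible (m , λ _ → refl) (encode-nonzero G indep m (p , mₚ≢𝟎)) weight≡Δ
                           (insertAt m′ p 𝟎 , encode-punchIn G p m′) (not-multiple m′ m′≢𝟎) s) Δ≡∑μ)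
  where
  c = encode G m
  Δ≡∑μ : Δ ≡ sum (weight₁ ∘ c)
  Δ≡∑μ = trans (sym weight≡Δ) (weight≡sum c)
  U : GenMatrix k n
  U = G ∘ punchIn p
  not-multiple : ∀ m′ → NonZeroWord m′ → ∀ a → ¬ (∀ j → encode U m′ j ≡ a ⊗ c j)
  not-multiple m′ (i , m′ᵢ≢𝟎) a multiple = m′ᵢ≢𝟎 (begin
    m′ i                             ≡⟨ sym (insertAt-punchIn m′ p 𝟎 i) ⟩
    insertAt m′ p 𝟎 (punchIn p i)    ≡⟨ proportional (punchIn p i) ⟩
    a ⊗ m (punchIn p i)              ≡⟨ cong (_⊗ m (punchIn p i)) a≡𝟎 ⟩
    𝟎                                ∎)
    where
    open ≡-Reasoning
    proportional : ∀ i → insertAt m′ p 𝟎 i ≡ a ⊗ m i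
    proportional = encode-injective G indep _ _ (λ j →
      trans (sym (encode-punchIn G p m′ j)) (trans (multiple j) (sym (encode-scale G m a j))))
    a≡𝟎 : a ≡ 𝟎
    a≡𝟎 = x⊗y≡𝟎⇒x≡𝟎 a (m p) mₚ≢𝟎 (trans (sym (proportional p)) (insertAt-lookup m′ p 𝟎))

weight≥2Δ : ∀ {k n Δ} (G : GenMatrix (suc k) n) → LinIndep G → IsMinimalCode G → IsDivisible Δ G →
  ¬ 4 ^ k ∣ Δ → ∀ m → NonZeroWord m → 2 * Δ ≤ weight (encode G m)
weight≥2Δ {Δ = Δ} G indep minimal divisible 4^k∤Δ m m≢𝟎 with divisible (encode G m) (m , λ _ → refl)
... | divides zero          weight≡0 = ⊥-elim (<⇒≢ (weight>0 _ (encode-nonzero G indep m m≢𝟎)) (sym weight≡0))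
... | divides (suc zero)    weight≡Δ =
  ⊥-elim (4^k∤Δ (weight≡Δ⇒4^k∣Δ G indep minimal divisible m m≢𝟎 (trans weight≡Δ (+-identityʳ Δ))))
... | divides (suc (suc q)) weight≡ = subst (2 * Δ ≤_) (sym weight≡) (*-monoˡ-≤ Δ (s≤s (s≤s (z≤n {q}))))

-- Averaging the weight over the code: 4ᵏ⁺¹ · 4ᵏ ≤ ∑ wt + 4ᵏ and 4 ∑ wt ≤ 3 n 4ᵏ⁺¹.
length-bound : ∀ {k n} (G : GenMatrix (suc k) n) →
  (∀ m → NonZeroWord m → 4 ^ k ≤ weight (encode G m)) → (4 ^ suc k ∸ 1) / 3 ≤ n
length-bound {k} {n} G weight≥ = arithmetic (4 ^ k) (∑ᵛ (suc k) (λ m → weight (encode G m)))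
  (∑ᵛ-lower-nonzero (suc k) (4 ^ k) _ weight≥) (weight-∑ᵛ G)
  where
  arithmetic : ∀ y S → (4 * y) * y ≤ S + y → 4 * S ≤ n * (3 * (4 * y)) → (4 * y ∸ 1) / 3 ≤ n
  arithmetic zero    S _ _ = z≤n
  arithmetic y@(suc _) S lower upper = begin
    (4 * y ∸ 1) / 3          ≤⟨ /-monoˡ-≤ 3 (∸-monoˡ-≤ 1 K≤3n+1) ⟩
    (n * 3 + 1 ∸ 1) / 3      ≡⟨ cong (_/ 3) (m+n∸n≡m (n * 3) 1) ⟩
    n * 3 / 3                ≡⟨ m*n/n≡m n 3 ⟩
    n                        ∎
    where
    open ≤-Reasoning
    K = 4 * y
    K≤3n+1 : K ≤ n * 3 + 1
    K≤3n+1 = *-cancelˡ-≤ K (begin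
      K * K                  ≡⟨ solve₁ y ⟩
      4 * (K * y)            ≤⟨ *-monoʳ-≤ 4 lower ⟩
      4 * (S + y)            ≡⟨ *-distribˡ-+ 4 S y ⟩
      4 * S + K              ≤⟨ +-monoˡ-≤ K upper ⟩
      n * (3 * K) + K        ≡⟨ solve₂ K n ⟩
      K * (n * 3 + 1)        ∎)
      where
      solve₁ : ∀ y → (4 * y) * (4 * y) ≡ 4 * ((4 * y) * y)
      solve₁ = solve-∀
      solve₂ : ∀ K n → n * (3 * K) + K ≡ K * (n * 3 + 1)
      solve₂ = solve-∀

2Δ≡4^[1+k] : ∀ k → 2 * 2 ^ (2 * (2 + k) ∸ 3) ≡ 4 ^ (1 + k)
2Δ≡4^[1+k] k = begin
  2 * 2 ^ (2 * (2 + k) ∸ 3)       ≡⟨ cong (λ e → 2 * 2 ^ (e ∸ 3)) (exponent₁ k) ⟩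
  2 * 2 ^ (3 + (1 + 2 * k) ∸ 3)   ≡⟨ cong (λ e → 2 * 2 ^ e) (m+n∸m≡n 3 (1 + 2 * k)) ⟩
  2 ^ (2 + 2 * k)                 ≡⟨ cong (2 ^_) (exponent₂ k) ⟩
  2 ^ (2 * (1 + k))               ≡⟨ sym (^-*-assoc 2 2 (1 + k)) ⟩
  4 ^ (1 + k)                     ∎
  where
  open ≡-Reasoning
  exponent₁ : ∀ k → 2 * (2 + k) ≡ 3 + (1 + 2 * k)
  exponent₁ = solve-∀
  exponent₂ : ∀ k → 2 + 2 * k ≡ 2 * (1 + k)
  exponent₂ = solve-∀

4^[1+k]∤Δ : ∀ k → ¬ 4 ^ (1 + k) ∣ 2 ^ (2 * (2 + k) ∸ 3)
4^[1+k]∤Δ k 4^[1+k]∣Δ = <⇒≱ Δ<4^[1+k] (∣⇒≤ {{m^n≢0 2 (2 * (2 + k) ∸ 3)}} 4^[1+k]∣Δ)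
  where
  Δ = 2 ^ (2 * (2 + k) ∸ 3)
  Δ<4^[1+k] : Δ < 4 ^ (1 + k)
  Δ<4^[1+k] = subst (Δ <_) (trans (cong (Δ +_) (sym (+-identityʳ Δ))) (2Δ≡4^[1+k] k)) (m<m+n Δ (m^n>0 2 (2 * (2 + k) ∸ 3)))

simplex-isDivMinCode : ∀ k Δ → Δ ∣ 4 ^ k → IsDivMinCode Δ (suc k) (simplexLength (suc k)) (simplex (suc k))
simplex-isDivMinCode k Δ (divides q 4^k≡qΔ) =
  simplex-indep k , constant-weight⇒minimal (simplex (suc k)) (4 ^ k) (simplex-codeword-weight k) , divisible
  where
  divisible : IsDivisible Δ (simplex (suc k))
  divisible c c∈G with zero-or-nonzero c
  ... | inj₁ c≡𝟎 = divides 0 (weight-𝟎 c c≡𝟎)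
  ... | inj₂ c≢𝟎 = divides q (trans (simplex-codeword-weight k c c∈G c≢𝟎) 4^k≡qΔ)

mainTheorem4 : ∀ (k : ℕ) → 2 ≤ k →
    MinLengthIs k (2 ^ (2 * k ∸ 3)) ((4 ^ k ∸ 1) / 3)
mainTheorem4 (suc zero) (s≤s ())
mainTheorem4 (suc (suc k)) _ = simplex-attains , lower
  where
  Δ = 2 ^ (2 * (2 + k) ∸ 3)
  simplex-attains : Σ (GenMatrix (2 + k) ((4 ^ (2 + k) ∸ 1) / 3)) (IsDivMinCode Δ (2 + k) ((4 ^ (2 + k) ∸ 1) / 3))
  simplex-attains = subst (λ N → Σ (GenMatrix (2 + k) N) (IsDivMinCode Δ (2 + k) N))
                          (simplexLength≡ (2 + k)) (simplex (2 + k) , simplex-isDivMinCode (1 + k) Δ (divides 2 (sym (2Δ≡4^[1+k] k))))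
  lower : ∀ n (G : GenMatrix (2 + k) n) → IsDivMinCode Δ (2 + k) n G → (4 ^ (2 + k) ∸ 1) / 3 ≤ n
  lower n G (indep , minimal , divisible) = length-bound G λ m m≢𝟎 →
    subst (_≤ weight (encode G m)) (2Δ≡4^[1+k] k) (weight≥2Δ G indep minimal divisible (4^[1+k]∤Δ k) m m≢𝟎)
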